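{- Let $\mathcal{G}$ be a TSLP in normal form with $t = \mathsf{val}(\mathcal{G})$. Let $T'$ be an initial subtree of the derivation tree $T_\mathcal{G}$ and let $v_1, \ldots, v_l$ be the sequence of all leaves of $T'$ (in left-to-right order). Then $2|t| \geq \sum_{i=1}^l |s_{v_i}|$.
   Context: $\Sigma$ is a finite alphabet. Trees are finite full binary trees labelled by $\Sigma$ and $|t|$ is the number of leaves. A context is such a tree over $\Sigma\cup\{x\}$ with exactly one leaf labelled $x$; $|c|$ is its number of leaves not counting $x$; $c[s]$ replaces $x$ by $s$. A TSLP in normal form is $\mathcal{G}=(V,A_0,r)$ with nonterminals $V=\{A_0,\dots,A_{m-1}\}$, each of rank $0$ or $1$ ($V_0,V_1$; $A_0\in V_0$), such that: for $A_i\in V_0$, $r(A_i)=A_j(\alpha)$ with $A_j\in V_1$, $\alpha\in V_0\cup\Sigma$; for $A_i\in V_1$, $r(A_i)$ is $A_j(A_k(x))$ ($A_j,A_k\in V_1$), or $a(\alpha,x)$ or $a(x,\alpha)$ ($a\in\Sigma$, $\alpha\in V_0\cup\Sigma$); the relation "$B$ occurs in $r(A)$" is acyclic. Values: $\mathsf{val}(a)=a$; $\mathsf{val}(A_i)=\mathsf{val}(A_j)[\mathsf{val}(\alpha)]$, $\mathsf{val}(A_j)[\mathsf{val}(A_k)]$, $a(\mathsf{val}(\alpha),x)$, $a(x,\mathsf{val}(\alpha))$ in the four respective cases; so $\mathsf{val}(A)$ is a tree for $A\in V_0$ and a context for $A\in V_1$. Let $\rho(A_i)$ be the length-2 word $A_j\alpha$,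 $A_jA_k$, $a\alpha$, $a\alpha$ respectively, and $\rho_\mathcal{G}=\rho(A_0)\cdots\rho(A_{m-1})$; it is required that $\rho_\mathcal{G}=A_1u_1A_2u_2\cdots A_{m-1}u_{m-1}$ with $u_i\in(\Sigma\cup\{A_1,\dots,A_i\})^*$, and that $\mathsf{val}(A_i)\ne\mathsf{val}(A_j)$ for $i\ne j$. Also the single-rule TSLP $A_0\to a$ ($a\in\Sigma$) is a normal-form TSLP. $\mathsf{val}(\mathcal{G})=\mathsf{val}(A_0)$. The derivation tree $T_\mathcal{G}$ is the binary tree with labels from $V\cup\Sigma$ whose root is labelled $A_0$; a node labelled $A_i$ with $\rho(A_i)=\alpha\beta$ has a left child labelled $\alpha$ and a right child labelled $\beta$; nodes labelled with symbols of $\Sigma$ are leaves. For a node $u$ of $T_\mathcal{G}$ with label $\alpha$, $s_u=\mathsf{val}(\alpha)$. An initial subtree of $T_\mathcal{G}$ is obtained by choosing a set $U$ of nodes of $T_\mathcal{G}$ and removing all nodes strictly below nodes of $U$. -}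

module Defs where

open import Data.Nat using (ℕ; zero; suc; _+_; _*_; _∸_; _≤_)
open import Data.Fin using (Fin; toℕ)
import Data.Fin as Fin
open import Data.List using (List; []; _∷_; _++_; map; length; concatMap)
open import Data.List.Relation.Unary.All using (All)
open import Data.Maybe using (Maybe; just; nothing)
open import Data.Product using (Σ; _×_; _,_; ∃)
open import Data.Sum using (_⊎_; inj₁; inj₂)
open import Data.Unit using (⊤)
open import Data.Empty using (⊥)
open import Data.Vec using (toList)
open import Data.Vec using (allFin)
open import Relation.Nullary using (¬_)
open import Relation.Binary.PropositionalEquality using (_≡_; _≢_)
open import Relation.Binary.Construct.Closure.Transitive using (TransClosure)

data Tree (k : ℕ) : Set where
  leaf : Fin k → Tree k
  node : Fin k → Tree k → Tree k → Tree k

-- contexts: full binary trees over Fin k ∪ {x} with exactly one leaf x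
data Ctx (k : ℕ) : Set where
  hole : Ctx k
  nodeˡ : Fin k → Ctx k → Tree k → Ctx k
  nodeʳ : Fin k → Tree k → Ctx k → Ctx k

size : ∀ {k} → Tree k → ℕ
size (leaf a) = 1
size (node a l r) = size l + size r

sizeC : ∀ {k} → Ctx k → ℕ
sizeC hole = 0
sizeC (nodeˡ a c t) = sizeC c + size t
sizeC (nodeʳ a t c) = size t + sizeC c

_[_] : ∀ {k} → Ctx k → Tree k → Tree k
hole [ s ] = s
nodeˡ a c t [ s ] = node a (c [ s ]) t
nodeʳ a t c [ s ] = node a t (c [ s ])

_[_]ᶜ : ∀ {k} → Ctx k → Ctx k → Ctx k
hole [ d ]ᶜ = d
nodeˡ a c t [ d ]ᶜ = nodeˡ a (c [ d ]ᶜ) t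
nodeʳ a t c [ d ]ᶜ = nodeʳ a t (c [ d ]ᶜ)

-- a value: a tree (rank 0) or a context (rank 1)
Value : ℕ → Set
Value k = Tree k ⊎ Ctx k

sizeV : ∀ {k} → Value k → ℕ
sizeV (inj₁ t) = size t
sizeV (inj₂ c) = sizeC c

-- TSLPs: nonterminals A_0 .. A_{m-1} are Fin m

data Sym (k m : ℕ) : Set where
  nt : Fin m → Sym k m
  tm : Fin k → Sym k m

data Rule (k m : ℕ) : Set where
  app  : Fin m → Sym k m → Rule k m
  comp : Fin m → Fin m → Rule k m
  lft  : Fin k → Sym k m → Rule k m        -- a(α, x)
  rgt  : Fin k → Sym k m → Rule k m        -- a(x, α)
  term : Fin k → Rule k m                  -- A_0 → a (single-rule TSLP only)

ρ : ∀ {k m} → Rule k m → Maybe (Sym k m × Sym k m)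
ρ (app j α)  = just (nt j , α)
ρ (comp j l) = just (nt j , nt l)
ρ (lft a α)  = just (tm a , α)
ρ (rgt a α)  = just (tm a , α)
ρ (term a)   = nothing

ρword : ∀ {k m} → Rule k m → List (Sym k m)
ρword r with ρ r
... | just (α , β) = α ∷ β ∷ []
... | nothing = []

ρG : ∀ {k m} → (Fin m → Rule k m) → List (Sym k m)
ρG {m = m} rule = concatMap (λ i → ρword (rule i)) (toList (allFin m))

valS : ∀ {k m} → (Fin m → Value k) → Sym k m → Value k
valS val (nt i) = val i
valS val (tm a) = inj₁ (leaf a)

Eqn : ∀ {k m} → (Fin m → Value k) → Rule k m → Value k → Set
Eqn {k} val (app j α) v =
  Σ (Ctx k) λ c → Σ (Tree k) λ s → val j ≡ inj₂ c × valS val α ≡ inj₁ s × v ≡ inj₁ (c [ s ])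
Eqn {k} val (comp j l) v =
  Σ (Ctx k) λ c → Σ (Ctx k) λ d → val j ≡ inj₂ c × val l ≡ inj₂ d × v ≡ inj₂ (c [ d ]ᶜ)
Eqn {k} val (lft a α) v =
  Σ (Tree k) λ s → valS val α ≡ inj₁ s × v ≡ inj₂ (nodeʳ a s hole)
Eqn {k} val (rgt a α) v =
  Σ (Tree k) λ s → valS val α ≡ inj₁ s × v ≡ inj₂ (nodeˡ a hole s)
Eqn val (term a) v = v ≡ inj₁ (leaf a)

-- val is the valuation of the grammar: it satisfies all defining equations
-- (these equations also encode the rank constraints: A_j must have a context
-- as value, α a tree, etc.)
IsVal : ∀ {k m} → (Fin m → Rule k m) → (Fin m → Value k) → Set
IsVal rule val = ∀ i → Eqn val (rule i) (val i)

OccursIn : ∀ {k m} → (Fin m → Rule k m) → Fin m → Fin m → Set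
OccursIn {k} {m} rule B A =
  Σ (Sym k m) λ β → Σ (Sym k m) λ γ → ρ (rule A) ≡ just (β , γ) × (β ≡ nt B ⊎ γ ≡ nt B)

Acyclic : ∀ {k m} → (Fin m → Rule k m) → Set
Acyclic rule = ∀ i → ¬ TransClosure (OccursIn rule) i i

-- ordering condition on ρ_G, with nonterminals identified by their index
data SymN (k : ℕ) : Set where
  ntN : ℕ → SymN k
  tmN : Fin k → SymN k

labN : ∀ {k m} → Sym k m → SymN k
labN (nt i) = ntN (toℕ i)
labN (tm a) = tmN a

layout : ∀ {k} → ℕ → List (List (SymN k)) → List (SymN k)
layout i [] = []
layout i (u ∷ us) = ntN i ∷ (u ++ layout (suc i) us)

Allowed : ∀ {k} → ℕ → SymN k → Set
Allowed i (ntN j) = 1 ≤ j × j ≤ i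
Allowed i (tmN a) = ⊤

GoodUs : ∀ {k} → ℕ → List (List (SymN k)) → Set
GoodUs i [] = ⊤
GoodUs i (u ∷ us) = All (Allowed i) u × GoodUs (suc i) us

-- ρ_G = A_1 u_1 A_2 u_2 ⋯ A_{m-1} u_{m-1}, u_i ∈ (Σ ∪ {A_1..A_i})*
OrderedρG : ∀ {k m} → (Fin m → Rule k m) → Set
OrderedρG {k} {m} rule =
  Σ (List (List (SymN k))) λ us →
    length us ≡ m ∸ 1 × GoodUs 1 us × map labN (ρG rule) ≡ layout 1 us

NoTerm : ∀ {k m} → Rule k m → Set
NoTerm (term a) = ⊥
NoTerm _ = ⊤

IsApp : ∀ {k m} → Rule k m → Set
IsApp (app j α) = ⊤
IsApp _ = ⊥

data NormalForm {k n : ℕ} (rule : Fin (suc n) → Rule k (suc n))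
                (val : Fin (suc n) → Value k) : Set where
  single  : n ≡ 0 → (a : Fin k) → rule Fin.zero ≡ term a → NormalForm rule val
  general : (∀ i → NoTerm (rule i)) →
            IsApp (rule Fin.zero) →                 -- A_0 ∈ V_0
            Acyclic rule →
            OrderedρG rule →
            (∀ i j → i ≢ j → val i ≢ val j) →
            NormalForm rule val

-- Initial subtrees of the derivation tree T_G, rooted at a node labelled α.
-- `cut` : the node is a leaf of T' (all nodes below it are removed);
-- `expand` : the node keeps its two children (left child β, right child γ).
data Initial {k m : ℕ} (rule : Fin m → Rule k m) : Sym k m → Set where
  cut    : ∀ {α} → Initial rule α
  expand : ∀ {i β γ} → ρ (rule i) ≡ just (β , γ) →
           Initial rule β → Initial rule γ → Initial rule (nt i)

leaves : ∀ {k m} {rule : Fin m → Rule k m} {α} → Initial rule α → List (Sym k m)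
leaves {α = α} cut = α ∷ []
leaves (expand _ l r) = leaves l ++ leaves r

-- Give every tree-valued symbol one unit of credit.  For each node of the
-- derivation tree, twice the size of its value plus the credits of its children
-- equals twice the sizes of the children plus its own credit: sizes add up
-- along every rule, except for a(α, x) and a(x, α), where the leaf a is lost
-- but both children carry a credit and the parent none.  Hence, by induction
-- on the initial subtree, the leaf sizes plus the root credit are at most
-- twice the size of the root value.
module Submission where

open import Defs
open import Algebra.Properties.CommutativeSemigroup using (xy∙z≈xz∙y)
open import Data.Fin using (Fin; zero)
open import Data.List using ([]; _∷_; map)
open import Data.List.Properties using (map-++)
open import Data.Maybe using (just)
open import Data.Nat using (ℕ; suc; _+_; _*_; _≤_; s≤s; z≤n)
open import Data.Nat.ListAction using (sum)
open import Data.Nat.ListAction.Properties using (sum-++)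
open import Data.Nat.Properties
  using ( ≤-trans; m≤m+n; +-mono-≤; +-monoʳ-≤; +-cancelʳ-≤; +-assoc; +-comm; +-identityʳ
        ; *-distribˡ-+; *-suc; +-commutativeSemigroup; module ≤-Reasoning)
open import Data.Nat.Tactic.RingSolver using (solve)
open import Data.Product using (_,_)
open import Data.Sum using (inj₁; inj₂)
open import Relation.Binary.PropositionalEquality using (_≡_; refl; sym; trans; cong)

size-positive : ∀ {k} (t : Tree k) → 1 ≤ size t
size-positive (leaf a)     = s≤s z≤n
size-positive (node a l r) = ≤-trans (size-positive l) (m≤m+n (size l) (size r))

size-[] : ∀ {k} (c : Ctx k) (s : Tree k) → size (c [ s ]) ≡ sizeC c + size s
size-[] hole          s = refl
size-[] (nodeˡ a c t) s rewrite size-[] c s = xy∙z≈xz∙y +-commutativeSemigroup (sizeC c) (size s) (size t)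
size-[] (nodeʳ a t c) s rewrite size-[] c s = sym (+-assoc (size t) (sizeC c) (size s))

sizeC-[]ᶜ : ∀ {k} (c d : Ctx k) → sizeC (c [ d ]ᶜ) ≡ sizeC c + sizeC d
sizeC-[]ᶜ hole          d = refl
sizeC-[]ᶜ (nodeˡ a c t) d rewrite sizeC-[]ᶜ c d = xy∙z≈xz∙y +-commutativeSemigroup (sizeC c) (sizeC d) (size t)
sizeC-[]ᶜ (nodeʳ a t c) d rewrite sizeC-[]ᶜ c d = sym (+-assoc (size t) (sizeC c) (sizeC d))

credit : ∀ {k} → Value k → ℕ
credit (inj₁ _) = 1
credit (inj₂ _) = 0

credit≤sizeV : ∀ {k} (v : Value k) → credit v ≤ sizeV v
credit≤sizeV (inj₁ t) = size-positive t
credit≤sizeV (inj₂ c) = z≤n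

bound-transfer : ∀ {x y b g c B G V : ℕ} → x + b ≤ 2 * B → y + g ≤ 2 * G →
  b + g + 2 * V ≡ c + 2 * (B + G) → x + y + c ≤ 2 * V
bound-transfer {x} {y} {b} {g} {c} {B} {G} {V} xb yg balance =
  +-cancelʳ-≤ (b + g) (x + y + c) (2 * V) (begin
    x + y + c + (b + g)       ≡⟨ solve (x ∷ y ∷ b ∷ g ∷ c ∷ []) ⟩
    c + ((x + b) + (y + g))   ≤⟨ +-monoʳ-≤ c (+-mono-≤ xb yg) ⟩
    c + (2 * B + 2 * G)       ≡⟨ cong (c +_) (*-distribˡ-+ 2 B G) ⟨
    c + 2 * (B + G)           ≡⟨ balance ⟨
    b + g + 2 * V             ≡⟨ +-comm (b + g) (2 * V) ⟩
    2 * V + (b + g)           ∎)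
  where open ≤-Reasoning

module _ {k m : ℕ} (val : Fin m → Value k) where

  ∥_∥ : Sym k m → ℕ
  ∥ α ∥ = sizeV (valS val α)

  credit-balance : ∀ (r : Rule k m) {v β γ} → ρ r ≡ just (β , γ) → Eqn val r v →
    credit (valS val β) + credit (valS val γ) + 2 * sizeV v ≡ credit v + 2 * (∥ β ∥ + ∥ γ ∥)
  credit-balance (app j α) refl (c , s , valj , valα , refl)
    rewrite valj | valα | size-[] c s = refl
  credit-balance (comp j l) refl (c , d , valj , vall , refl)
    rewrite valj | vall | sizeC-[]ᶜ c d = refl
  credit-balance (lft a α) refl (s , valα , refl)
    rewrite valα = trans (cong (λ n → 2 + 2 * n) (+-identityʳ (size s))) (sym (*-suc 2 (size s)))
  credit-balance (rgt a α) refl (s , valα , refl)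
    rewrite valα = sym (*-suc 2 (size s))

  leafSum : ∀ {rule : Fin m → Rule k m} {α} → Initial rule α → ℕ
  leafSum T = sum (map ∥_∥ (leaves T))

  leafSum-expand : ∀ {rule : Fin m → Rule k m} {i β γ} (e : ρ (rule i) ≡ just (β , γ))
    (l : Initial rule β) (r : Initial rule γ) → leafSum (expand e l r) ≡ leafSum l + leafSum r
  leafSum-expand e l r rewrite map-++ ∥_∥ (leaves l) (leaves r) =
    sum-++ (map ∥_∥ (leaves l)) (map ∥_∥ (leaves r))

  leafSum+credit≤2*size : ∀ {rule : Fin m → Rule k m} → IsVal rule val →
    ∀ {α} (T : Initial rule α) → leafSum T + credit (valS val α) ≤ 2 * ∥ α ∥
  leafSum+credit≤2*size isVal {α} cut = begin
    ∥ α ∥ + 0 + credit (valS val α)   ≡⟨ cong (_+ credit (valS val α)) (+-identityʳ ∥ α ∥) ⟩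
    ∥ α ∥ + credit (valS val α)       ≤⟨ +-monoʳ-≤ ∥ α ∥ (credit≤sizeV (valS val α)) ⟩
    ∥ α ∥ + ∥ α ∥                     ≡⟨ cong (∥ α ∥ +_) (+-identityʳ ∥ α ∥) ⟨
    2 * ∥ α ∥                         ∎
    where open ≤-Reasoning
  leafSum+credit≤2*size {rule} isVal (expand {i} {β} {γ} e l r) rewrite leafSum-expand e l r =
    bound-transfer {x = leafSum l} {y = leafSum r} {B = ∥ β ∥} {G = ∥ γ ∥} {V = ∥ nt i ∥}
      (leafSum+credit≤2*size isVal l) (leafSum+credit≤2*size isVal r)
      (credit-balance (rule i) e (isVal i))

mainTheorem5 : (k n : ℕ) (rule : Fin (suc n) → Rule k (suc n)) (val : Fin (suc n) → Value k) →
    IsVal rule val → NormalForm rule val →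
    (t : Tree k) → val zero ≡ inj₁ t →
    (T′ : Initial rule (nt zero)) →
      sum (map (λ α → sizeV (valS val α)) (leaves T′)) ≤ 2 * size t
mainTheorem5 k n rule val isVal _ t valA₀ T′ = begin
  leafSum val T′                      ≤⟨ m≤m+n (leafSum val T′) (credit (val zero)) ⟩
  leafSum val T′ + credit (val zero)  ≤⟨ leafSum+credit≤2*size val isVal T′ ⟩
  2 * sizeV (val zero)                ≡⟨ cong (λ v → 2 * sizeV v) valA₀ ⟩
  2 * size t                          ∎
  where open ≤-Reasoning
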